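{- (i) Let $m,n$ be distinct positive integers and let $\mathcal{A}$ and $\mathcal{B}$ be intervals of residue classes modulo $m$ and $n$, respectively, with $|\mathcal{A}|>\frac13 m$ and $|\mathcal{B}|>\frac13 n$. Then there exist $(a,b)\in\mathcal{A}\times\mathcal{B}$ and an integer $x$ with $x\equiv a\pmod m$ and $x\equiv b\pmod n$. (ii) The constant $\frac13$ cannot be replaced by any smaller constant: for every real $c<\frac13$ there exist distinct positive integers $m,n$ and intervals $\mathcal{A},\mathcal{B}$ of residue classes modulo $m$ and $n$, respectively, with $|\mathcal{A}|>cm$ and $|\mathcal{B}|>cn$, such that for no $(a,b)\in\mathcal{A}\times\mathcal{B}$ does the system $x\equiv a\pmod m$, $x\equiv b\pmod n$ have an integer solution.
   Context: An interval of residue classes modulo $m$ is a set of the form $\{c,c+1,\ldots,c+L-1\}\bmod m\subseteq\mathbb{Z}/m\mathbb{Z}$ for some integer $c$ and some integer $0\le L\le m$ (consecutive residues, taken cyclically); its size is $L$.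
   Formalization: In part (ii) the constant c ranges over the rationals instead of the reals. -}

module Defs where

open import Data.Nat as ℕ using (ℕ; _≤_; _<_)
open import Data.Integer as ℤ using (ℤ; +_; _+_; _-_)
open import Data.Integer.Divisibility using (_∣_)
open import Data.Product using (Σ; ∃-syntax; _×_)

_≡_[mod_] : ℤ → ℤ → ℕ → Set
x ≡ y [mod m ] = (+ m) ∣ (x - y)

-- An interval of residue classes modulo m: {c, c+1, ..., c+L-1} mod m with 0 ≤ L ≤ m.
record Interval (m : ℕ) : Set where
  constructor interval
  field
    start  : ℤ
    size   : ℕ
    size≤m : size ≤ m
open Interval public

_∈I_ : {m : ℕ} → ℤ → Interval m → Set
_∈I_ {m} a I = ∃[ k ] (k < size I × a ≡ start I + + k [mod m ])

Solvable : (m n : ℕ) → Interval m → Interval n → Set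
Solvable m n A B =
  ∃[ a ] ∃[ b ] ∃[ x ] (a ∈I A × b ∈I B × x ≡ a [mod m ] × x ≡ b [mod n ])

-- Part (i).  Put g = gcd m n.  By the Chinese remainder theorem the system
-- x ≡ a (mod m), x ≡ b (mod n) is solvable as soon as g ∣ b − a.  For the
-- intervals A = {s, …, s+L_A−1} and B = {t, …, t+L_B−1} the differences
-- b − a are (t − s) + l − k with k < L_A, l < L_B; these are L_A + L_B − 1
-- consecutive integers, so one of them is a multiple of g once g < L_A + L_B.
-- That inequality holds because m ≠ n are distinct positive multiples of g,
-- whence 3g ≤ m + n < 3 (L_A + L_B).
--
-- Part (ii).  Write c = p/q in lowest terms with q > 0.  If p ≥ 0 then
-- 3p < q, and the moduli 4q, 2q with A = [0, 4p+1) and B = [4p+1, 6p+2)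
-- form a counterexample: c·4q = 4p < |A|, c·2q = 2p < |B|, yet every
-- solution would force 2q to divide a number strictly between 0 and 2q.
-- For p < 0 the same family with q = 1, p = 0 works.
module Submission where

open import Defs
open import Data.Nat as ℕ using (ℕ; suc; NonZero; z≤n; s≤s)
import Data.Nat.Properties as NP
open import Data.Nat.Divisibility as ND using (divides)
open import Data.Nat.GCD using (gcd; gcd-GCD; gcd[m,n]∣m; gcd[m,n]∣n; gcd[m,n]≢0; module Bézout)
open import Data.Nat.Coprimality using (Coprime)
open import Data.Nat.Tactic.RingSolver using (solve-∀)
open import Data.Integer as ℤ using (ℤ; +_; -[1+_])
import Data.Integer.Properties as ZP
import Data.Integer.Divisibility.Signed as S
open import Data.Integer.DivMod using (_%ℕ_; _/ℕ_; a≡a%ℕn+[a/ℕn]*n; n%ℕd<d)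
import Data.Integer.Tactic.RingSolver as ℤRing
open import Data.Rational as ℚ using (ℚ; _/_; mkℚ)
import Data.Rational.Properties as ℚP
import Data.Rational.Unnormalised as ℚᵘ
import Data.Rational.Unnormalised.Properties as ℚᵘP
open import Data.Product using (∃-syntax; _×_; _,_)
open import Data.Sum using (inj₁)
open import Data.Empty using (⊥-elim)
open import Relation.Nullary using (¬_; yes; no)
open import Relation.Binary.PropositionalEquality

mod-refl : ∀ {m} x → x ≡ x [mod m ]
mod-refl {m} x = subst (m ND.∣_) (cong ℤ.∣_∣ (sym (ZP.+-inverseʳ x))) (ND._∣0 m)

mod-sym : ∀ {m} x y → x ≡ y [mod m ] → y ≡ x [mod m ]
mod-sym {m} x y = subst (m ND.∣_) (ZP.∣i-j∣≡∣j-i∣ x y)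

mod-trans : ∀ {m} x y z → x ≡ y [mod m ] → y ≡ z [mod m ] → x ≡ z [mod m ]
mod-trans {m} x y z x≡y y≡z =
  S.∣⇒∣ᵤ (subst (+ m S.∣_) (telescope x y z) (S.∣m∣n⇒∣m+n {+ m} {x ℤ.- y} {y ℤ.- z} (S.∣ᵤ⇒∣ x≡y) (S.∣ᵤ⇒∣ y≡z)))
  where
  telescope : ∀ x y z → (x ℤ.- y) ℤ.+ (y ℤ.- z) ≡ x ℤ.- z
  telescope = ℤRing.solve-∀

mod-divisor : ∀ {g m} x y → g ND.∣ m → x ≡ y [mod m ] → x ≡ y [mod g ]
mod-divisor _ _ = ND.∣-trans

bezout-lift : ∀ g x y m n → g ℕ.+ y ℕ.* n ≡ x ℕ.* m → + x ℤ.* + m ℤ.- + y ℤ.* + n ≡ + g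
bezout-lift g x y m n e = begin
  + x ℤ.* + m ℤ.- + y ℤ.* + n              ≡⟨ cong (ℤ._- (+ y ℤ.* + n)) x·m≡g+y·n ⟩
  (+ g ℤ.+ + y ℤ.* + n) ℤ.- + y ℤ.* + n   ≡⟨ cancel (+ g) (+ y ℤ.* + n) ⟩
  + g                                      ∎
  where
  open ≡-Reasoning
  x·m≡g+y·n : + x ℤ.* + m ≡ + g ℤ.+ + y ℤ.* + n
  x·m≡g+y·n = begin
    + x ℤ.* + m            ≡⟨ ZP.pos-* x m ⟨
    + (x ℕ.* m)            ≡⟨ cong +_ e ⟨
    + (g ℕ.+ y ℕ.* n)      ≡⟨ ZP.pos-+ g (y ℕ.* n) ⟩
    + g ℤ.+ + (y ℕ.* n)    ≡⟨ cong (λ z → + g ℤ.+ z) (ZP.pos-* y n) ⟩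
    + g ℤ.+ + y ℤ.* + n    ∎
  cancel : ∀ a b → (a ℤ.+ b) ℤ.- b ≡ a
  cancel = ℤRing.solve-∀

-- Bézout's identity over ℤ: gcd m n is an integer combination of m and n.
-- The library states it over ℕ as one of two equations.
bezout : ∀ m n → ∃[ u ] ∃[ v ] (u ℤ.* + m ℤ.+ v ℤ.* + n ≡ + gcd m n)
bezout m n with Bézout.identity (gcd-GCD m n)
... | Bézout.Identity.+- x y eq =
  + x , ℤ.- + y , trans (rearrange (+ x) (+ m) (+ y) (+ n)) (bezout-lift (gcd m n) x y m n eq)
  where
  rearrange : ∀ a b c d → a ℤ.* b ℤ.+ ℤ.- c ℤ.* d ≡ a ℤ.* b ℤ.- c ℤ.* d
  rearrange = ℤRing.solve-∀
... | Bézout.Identity.-+ x y eq =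
  ℤ.- + x , + y , trans (rearrange (+ x) (+ m) (+ y) (+ n)) (bezout-lift (gcd m n) y x n m eq)
  where
  rearrange : ∀ a b c d → ℤ.- a ℤ.* b ℤ.+ c ℤ.* d ≡ c ℤ.* d ℤ.- a ℤ.* b
  rearrange = ℤRing.solve-∀

-- Chinese remainder theorem (existence half): if gcd m n divides b − a, the
-- system x ≡ a (mod m), x ≡ b (mod n) is solved by x = a + Q·u·m, where
-- b − a = Q · gcd m n and u·m + v·n = gcd m n.
crt : ∀ m n a b → + gcd m n S.∣ b ℤ.- a → ∃[ x ] (x ≡ a [mod m ] × x ≡ b [mod n ])
crt m n a b (S.divides Q b-a≡Q·g) with bezout m n
... | u , v , u·m+v·n≡g =
  a ℤ.+ Q ℤ.* u ℤ.* + m ,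
  S.∣⇒∣ᵤ (S.divides (Q ℤ.* u) (shift a (Q ℤ.* u) (+ m))) ,
  S.∣⇒∣ᵤ (S.divides (ℤ.- (Q ℤ.* v)) x-b≡multiple-of-n)
  where
  open ≡-Reasoning
  shift : ∀ a w m → a ℤ.+ w ℤ.* m ℤ.- a ≡ w ℤ.* m
  shift = ℤRing.solve-∀
  regroup : ∀ a b Q u m → a ℤ.+ Q ℤ.* u ℤ.* m ℤ.- b ≡ Q ℤ.* (u ℤ.* m) ℤ.- (b ℤ.- a)
  regroup = ℤRing.solve-∀
  simplify : ∀ Q u m v n → Q ℤ.* (u ℤ.* m) ℤ.- Q ℤ.* (u ℤ.* m ℤ.+ v ℤ.* n) ≡ ℤ.- (Q ℤ.* v) ℤ.* n
  simplify = ℤRing.solve-∀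
  x-b≡multiple-of-n : a ℤ.+ Q ℤ.* u ℤ.* + m ℤ.- b ≡ ℤ.- (Q ℤ.* v) ℤ.* + n
  x-b≡multiple-of-n = begin
    a ℤ.+ Q ℤ.* u ℤ.* + m ℤ.- b                                ≡⟨ regroup a b Q u (+ m) ⟩
    Q ℤ.* (u ℤ.* + m) ℤ.- (b ℤ.- a)                            ≡⟨ cong (λ z → Q ℤ.* (u ℤ.* + m) ℤ.- z) b-a≡Q·g ⟩
    Q ℤ.* (u ℤ.* + m) ℤ.- Q ℤ.* + gcd m n                      ≡⟨ cong (λ z → Q ℤ.* (u ℤ.* + m) ℤ.- Q ℤ.* z) u·m+v·n≡g ⟨
    Q ℤ.* (u ℤ.* + m) ℤ.- Q ℤ.* (u ℤ.* + m ℤ.+ v ℤ.* + n)     ≡⟨ simplify Q u (+ m) v (+ n) ⟩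
    ℤ.- (Q ℤ.* v) ℤ.* + n                                      ∎

-- Two distinct positive multiples of g add up to at least 3g: their
-- quotients by g are distinct positive integers, so they sum to at least 3.
sum-of-distinct-multiples : ∀ {g m n} → g ND.∣ m → g ND.∣ n →
  0 ℕ.< m → 0 ℕ.< n → m ≢ n → 3 ℕ.* g ℕ.≤ m ℕ.+ n
sum-of-distinct-multiples {g} (divides a refl) (divides b refl) 0<m 0<n m≢n = begin
  3 ℕ.* g              ≤⟨ NP.*-monoˡ-≤ g (three≤ a b 0<m 0<n (λ a≡b → m≢n (cong (ℕ._* g) a≡b))) ⟩
  (a ℕ.+ b) ℕ.* g      ≡⟨ NP.*-distribʳ-+ g a b ⟩
  a ℕ.* g ℕ.+ b ℕ.* g  ∎
  where
  open NP.≤-Reasoning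
  three≤ : ∀ a b → 0 ℕ.< a ℕ.* g → 0 ℕ.< b ℕ.* g → a ≢ b → 3 ℕ.≤ a ℕ.+ b
  three≤ 1 1 _ _ 1≢1 = ⊥-elim (1≢1 refl)
  three≤ 1 (suc (suc b)) _ _ _ = s≤s (s≤s (s≤s z≤n))
  three≤ (suc (suc a)) (suc b) _ _ _ = s≤s (s≤s (NP.≤-trans (s≤s z≤n) (NP.m≤n+m (suc b) a)))

-- Write δ = d + Q·g with 0 ≤ d < g and take
-- k = d, l = 0 if d < L_A, and k = 0, l = g − d otherwise.
offset-correction : ∀ g .{{_ : NonZero g}} (δ : ℤ) {LA LB} →
  0 ℕ.< LA → 0 ℕ.< LB → g ℕ.< LA ℕ.+ LB →
  ∃[ k ] ∃[ l ] (k ℕ.< LA × l ℕ.< LB × + g S.∣ δ ℤ.+ + l ℤ.- + k)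
offset-correction g δ {LA} {LB} 0<LA 0<LB g<LA+LB =
  correct (δ %ℕ g) (δ /ℕ g) (a≡a%ℕn+[a/ℕn]*n δ g) (n%ℕd<d δ g)
  where
  open ≡-Reasoning
  correct : ∀ d Q → δ ≡ + d ℤ.+ Q ℤ.* + g → d ℕ.< g →
    ∃[ k ] ∃[ l ] (k ℕ.< LA × l ℕ.< LB × + g S.∣ δ ℤ.+ + l ℤ.- + k)
  correct d Q δ≡d+Q·g d<g with d ℕ.<? LA
  ... | yes d<LA = d , 0 , d<LA , 0<LB , S.divides Q (begin
    δ ℤ.+ + 0 ℤ.- + d                   ≡⟨ cong (λ z → z ℤ.+ + 0 ℤ.- + d) δ≡d+Q·g ⟩
    + d ℤ.+ Q ℤ.* + g ℤ.+ + 0 ℤ.- + d   ≡⟨ cancel (+ d) (Q ℤ.* + g) ⟩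
    Q ℤ.* + g                           ∎)
    where
    cancel : ∀ d w → d ℤ.+ w ℤ.+ + 0 ℤ.- d ≡ w
    cancel = ℤRing.solve-∀
  ... | no d≮LA = 0 , g ℕ.∸ d , 0<LA , g-d<LB , S.divides (Q ℤ.+ + 1) (begin
    δ ℤ.+ + (g ℕ.∸ d) ℤ.- + 0                     ≡⟨ cong₂ (λ z w → z ℤ.+ w ℤ.- + 0) δ≡d+Q·g g∸d≡g-d ⟩
    + d ℤ.+ Q ℤ.* + g ℤ.+ (+ g ℤ.- + d) ℤ.- + 0   ≡⟨ complete (+ d) Q (+ g) ⟩
    (Q ℤ.+ + 1) ℤ.* + g                           ∎)
    where
    g∸d≡g-d : + (g ℕ.∸ d) ≡ + g ℤ.- + d
    g∸d≡g-d = sym (trans (ZP.m-n≡m⊖n g d) (ZP.⊖-≥ (NP.<⇒≤ d<g)))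
    complete : ∀ d Q g → d ℤ.+ Q ℤ.* g ℤ.+ (g ℤ.- d) ℤ.- + 0 ≡ (Q ℤ.+ + 1) ℤ.* g
    complete = ℤRing.solve-∀
    g-d<LB : g ℕ.∸ d ℕ.< LB
    g-d<LB = NP.m<n+o⇒m∸n<o g d {{ℕ.>-nonZero 0<LB}}
               (NP.<-≤-trans g<LA+LB (NP.+-monoˡ-≤ LB (NP.≮⇒≥ d≮LA)))

nonempty : ∀ {m L} → m ℕ.< 3 ℕ.* L → 0 ℕ.< L
nonempty {L = suc _} _ = s≤s z≤n

start+k∈ : ∀ {m} (I : Interval m) {k} → k ℕ.< size I → (start I ℤ.+ + k) ∈I I
start+k∈ I {k} k<size = k , k<size , mod-refl (start I ℤ.+ + k)

-- With g = gcd m n, the bound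
-- 3g ≤ m + n < 3(|A| + |B|) lets the covering lemma make the difference of
-- two residues divisible by g, and the Chinese remainder theorem applies.
large-intervals-solvable : (m n : ℕ) → 0 ℕ.< m → 0 ℕ.< n → m ≢ n →
  (A : Interval m) (B : Interval n) →
  m ℕ.< 3 ℕ.* size A → n ℕ.< 3 ℕ.* size B → Solvable m n A B
large-intervals-solvable m n 0<m 0<n m≢n A B m<3·|A| n<3·|B| =
  let k , l , k<|A| , l<|B| , g∣shifted-offset =
        offset-correction g (start B ℤ.- start A) (nonempty m<3·|A|) (nonempty n<3·|B|) g<|A|+|B|
      x , x≡a , x≡b =
        crt m n (start A ℤ.+ + k) (start B ℤ.+ + l)
          (subst (+ g S.∣_) (regroup (start A) (start B) (+ k) (+ l)) g∣shifted-offset)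
  in start A ℤ.+ + k , start B ℤ.+ + l , x , start+k∈ A k<|A| , start+k∈ B l<|B| , x≡a , x≡b
  where
  g : ℕ
  g = gcd m n
  instance
    g≢0 : NonZero g
    g≢0 = ℕ.≢-nonZero (gcd[m,n]≢0 m n (inj₁ (NP.n>0⇒n≢0 0<m)))
  g<|A|+|B| : g ℕ.< size A ℕ.+ size B
  g<|A|+|B| = NP.*-cancelˡ-< 3 g (size A ℕ.+ size B) (begin-strict
    3 ℕ.* g                          ≤⟨ sum-of-distinct-multiples (gcd[m,n]∣m m n) (gcd[m,n]∣n m n) 0<m 0<n m≢n ⟩
    m ℕ.+ n                          <⟨ NP.+-mono-< m<3·|A| n<3·|B| ⟩
    3 ℕ.* size A ℕ.+ 3 ℕ.* size B    ≡⟨ NP.*-distribˡ-+ 3 (size A) (size B) ⟨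
    3 ℕ.* (size A ℕ.+ size B)        ∎)
    where open NP.≤-Reasoning
  regroup : ∀ s t k l → (t ℤ.- s) ℤ.+ l ℤ.- k ≡ (t ℤ.+ l) ℤ.- (s ℤ.+ k)
  regroup = ℤRing.solve-∀

incongruent-below : ∀ {n j k} → k ℕ.< j → j ℕ.< n → ¬ ((+ j) ≡ (+ k) [mod n ])
incongruent-below {n} {j} {k} k<j j<n n∣j-k =
  NP.<⇒≱ (NP.≤-<-trans (NP.m∸n≤m j k) j<n) (ND.∣⇒≤ {{ℕ.>-nonZero (NP.m<n⇒0<n∸m k<j)}} n∣j∸k)
  where
  n∣j∸k : n ND.∣ j ℕ.∸ k
  n∣j∸k = subst (n ND.∣_) (cong ℤ.∣_∣ (trans (ZP.m-n≡m⊖n j k) (ZP.⊖-≥ (NP.<⇒≤ k<j)))) n∣j-k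

Counterexample : ℚ → Set
Counterexample c =
  ∃[ m ] ∃[ n ] (0 ℕ.< m × 0 ℕ.< n × m ≢ n ×
    ∃[ A ] ∃[ B ] (c ℚ.* ((+ m) / 1) ℚ.< (+ size A) / 1 ×
                   c ℚ.* ((+ n) / 1) ℚ.< (+ size B) / 1 ×
                   ¬ Solvable m n A B))

clear-denominator : (c : ℚ) (m s : ℕ) →
  ℚ.↥ c ℤ.* + m ℤ.< + s ℤ.* ℚ.↧ c → c ℚ.* ((+ m) / 1) ℚ.< (+ s) / 1
clear-denominator c@(mkℚ _ d _) m s h = ℚP.toℚᵘ-cancel-< (begin-strict
  ℚ.toℚᵘ (c ℚ.* ((+ m) / 1))                  ≃⟨ ℚP.toℚᵘ-homo-* c ((+ m) / 1) ⟩
  ℚ.toℚᵘ c ℚᵘ.* ℚ.toℚᵘ ((+ m) / 1)           ≃⟨ ℚᵘP.*-congˡ {ℚ.toℚᵘ c} (ℚP.toℚᵘ-fromℚᵘ (ℚᵘ.mkℚᵘ (+ m) 0)) ⟩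
  ℚ.toℚᵘ c ℚᵘ.* ℚᵘ.mkℚᵘ (+ m) 0             <⟨ ℚᵘ.*<* cross-multiplied ⟩
  ℚᵘ.mkℚᵘ (+ s) 0                             ≃⟨ ℚP.toℚᵘ-fromℚᵘ (ℚᵘ.mkℚᵘ (+ s) 0) ⟨
  ℚ.toℚᵘ ((+ s) / 1)                          ∎)
  where
  open ℚᵘP.≤-Reasoning
  cross-multiplied : ℚ.↥ c ℤ.* + m ℤ.* + 1 ℤ.< + s ℤ.* + (suc d ℕ.* 1)
  cross-multiplied = subst₂ ℤ._<_ (sym (ZP.*-identityʳ _)) (cong (λ z → + s ℤ.* + z) (sym (NP.*-identityʳ (suc d)))) h

-- For c = p/q the scaled value c·(kq) = kp stays below the size kp + 1.
scaled-numerator< : ∀ p k q → 0 ℕ.< q → + p ℤ.* + (k ℕ.* q) ℤ.< + suc (k ℕ.* p) ℤ.* + q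
scaled-numerator< p k q 0<q =
  subst₂ ℤ._<_ (ZP.pos-* p (k ℕ.* q)) (ZP.pos-* (suc (k ℕ.* p)) q) (ℤ.+<+ (begin-strict
    p ℕ.* (k ℕ.* q)        ≡⟨ reassociate p k q ⟩
    k ℕ.* p ℕ.* q          <⟨ NP.m<n+m (k ℕ.* p ℕ.* q) 0<q ⟩
    suc (k ℕ.* p) ℕ.* q    ∎))
  where
  open NP.≤-Reasoning
  reassociate : ∀ p k q → p ℕ.* (k ℕ.* q) ≡ k ℕ.* p ℕ.* q
  reassociate = solve-∀

numerator-bound : ∀ {p d} .{coprime : Coprime p (suc d)} → mkℚ (+ p) d coprime ℚ.< (+ 1) / 3 → 3 ℕ.* p ℕ.< suc d
numerator-bound {p} {d} (ℚ.*<* h) =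
  subst₂ ℕ._<_ (NP.*-comm p 3) (NP.*-identityˡ (suc d))
    (ZP.drop‿+<+ (subst₂ ℤ._<_ (sym (ZP.pos-* p 3)) (sym (ZP.pos-* 1 (suc d))) h))

module Extremal (q p : ℕ) (3p<q : 3 ℕ.* p ℕ.< q) where

  p<q : p ℕ.< q
  p<q = NP.≤-<-trans (NP.m≤n*m p 3) 3p<q

  0<q : 0 ℕ.< q
  0<q = NP.<-≤-trans (s≤s z≤n) 3p<q

  A : Interval (4 ℕ.* q)
  A = interval (+ 0) (suc (4 ℕ.* p)) (NP.*-monoʳ-< 4 p<q)

  B : Interval (2 ℕ.* q)
  B = interval (+ suc (4 ℕ.* p)) (suc (2 ℕ.* p)) (NP.*-monoʳ-< 2 p<q)

  distinct-moduli : 4 ℕ.* q ≢ 2 ℕ.* q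
  distinct-moduli 4q≡2q with NP.*-cancelʳ-≡ 4 2 q {{ℕ.>-nonZero 0<q}} 4q≡2q
  ... | ()

  -- A solution would give 4p+1+l ≡ k (mod 2q), as 2q divides 4q; but
  -- k ≤ 4p < 4p+1+l ≤ 6p+1 < 2q.
  unsolvable : ¬ Solvable (4 ℕ.* q) (2 ℕ.* q) A B
  unsolvable (a , b , x , (k , k<|A| , a≡k) , (l , l<|B| , b≡4p+1+l) , x≡a , x≡b) =
    incongruent-below k<4p+1+l 4p+1+l<2q 4p+1+l≡k
    where
    2q∣4q : 2 ℕ.* q ND.∣ 4 ℕ.* q
    2q∣4q = divides 2 (double q)
      where
      double : ∀ q → 4 ℕ.* q ≡ 2 ℕ.* (2 ℕ.* q)
      double = solve-∀
    4p+1+l≡k : (+ (suc (4 ℕ.* p) ℕ.+ l)) ≡ (+ k) [mod 2 ℕ.* q ]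
    4p+1+l≡k = mod-trans N b (+ k) (mod-sym b N b≡4p+1+l)
                 (mod-trans b x (+ k) (mod-sym x b x≡b) (mod-divisor x (+ k) 2q∣4q (mod-trans x a (+ k) x≡a a≡k)))
      where
      N : ℤ
      N = + (suc (4 ℕ.* p) ℕ.+ l)
    k<4p+1+l : k ℕ.< suc (4 ℕ.* p) ℕ.+ l
    k<4p+1+l = NP.<-≤-trans k<|A| (NP.m≤m+n (suc (4 ℕ.* p)) l)
    4p+1+l<2q : suc (4 ℕ.* p) ℕ.+ l ℕ.< 2 ℕ.* q
    4p+1+l<2q = begin-strict
      suc (4 ℕ.* p) ℕ.+ l                ≡⟨⟩
      suc (4 ℕ.* p ℕ.+ l)                <⟨ s≤s (NP.+-monoʳ-< (4 ℕ.* p) l<|B|) ⟩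
      suc (4 ℕ.* p ℕ.+ suc (2 ℕ.* p))    ≡⟨ regroup p ⟩
      2 ℕ.* suc (3 ℕ.* p)                ≤⟨ NP.*-monoʳ-≤ 2 3p<q ⟩
      2 ℕ.* q                            ∎
      where
      open NP.≤-Reasoning
      regroup : ∀ p → suc (4 ℕ.* p ℕ.+ suc (2 ℕ.* p)) ≡ 2 ℕ.* suc (3 ℕ.* p)
      regroup = solve-∀

  counterexample : (c : ℚ) →
    ℚ.↥ c ℤ.* + (4 ℕ.* q) ℤ.< + size A ℤ.* ℚ.↧ c →
    ℚ.↥ c ℤ.* + (2 ℕ.* q) ℤ.< + size B ℤ.* ℚ.↧ c → Counterexample c
  counterexample c c·4q<|A| c·2q<|B| =
    4 ℕ.* q , 2 ℕ.* q , NP.*-monoʳ-< 4 0<q , NP.*-monoʳ-< 2 0<q , distinct-moduli , A , B ,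
    clear-denominator c _ (size A) c·4q<|A| , clear-denominator c _ (size B) c·2q<|B| , unsolvable

threshold-sharp : (c : ℚ) → c ℚ.< (+ 1) / 3 → Counterexample c
threshold-sharp c@(mkℚ (+ p) d _) c<⅓ =
  Extremal.counterexample (suc d) p (numerator-bound c<⅓) c
    (scaled-numerator< p 4 (suc d) (s≤s z≤n)) (scaled-numerator< p 2 (suc d) (s≤s z≤n))
threshold-sharp c@(mkℚ -[1+ _ ] _ _) _ =
  Extremal.counterexample 1 0 (s≤s z≤n) c ℤ.-<+ ℤ.-<+

corollary2p4 :
  ((m n : ℕ) → 0 ℕ.< m → 0 ℕ.< n → m ≢ n →
    (A : Interval m) (B : Interval n) →
    m ℕ.< 3 ℕ.* size A → n ℕ.< 3 ℕ.* size B →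
    Solvable m n A B)
  ×
  ((c : ℚ) → c ℚ.< (+ 1) / 3 →
    ∃[ m ] ∃[ n ] (0 ℕ.< m × 0 ℕ.< n × m ≢ n ×
      ∃[ A ] ∃[ B ] (c ℚ.* ((+ m) / 1) ℚ.< (+ size A) / 1 ×
                     c ℚ.* ((+ n) / 1) ℚ.< (+ size B) / 1 ×
                     ¬ Solvable m n A B)))
corollary2p4 = large-intervals-solvable , threshold-sharp
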